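{- Let $(\mathcal{X},d)$ be a metric space, $S\subseteq\mathcal{X}$ a multiset of servers, and clients $c_1,c_2,\dots$ with $C_t=(c_1,\dots,c_t)$. Let $\mathcal{M}^*_{t-1}$ and $\mathcal{M}^*_{t+\ell}$ be minimum-cost matchings of $C_{t-1}$ and $C_{t+\ell}$ into $S$ whose used server sets satisfy $S^*_{t-1}\subseteq S^*_{t+\ell}$, where $S^*_j=\mathcal{M}^*_j(C_j)$. Let $C_{\mathrm{cur}}=C_{t+\ell}\setminus C_{t-1}$, $S_{\mathrm{cur}}=S^*_{t+\ell}\setminus S^*_{t-1}$, and let $\mathcal{M}_{\mathrm{cur}}$ be a minimum-cost perfect matching between $C_{\mathrm{cur}}$ and $S_{\mathrm{cur}}$. Then the cost of $\mathcal{M}_{\mathrm{cur}}$ is at most $2\,\mathrm{OPT}_{t+\ell}$, where $\mathrm{OPT}_{t+\ell}$ is the cost of $\mathcal{M}^*_{t+\ell}$.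
   Context: A matching of $C_j$ into $S$ assigns each client of $C_j$ a distinct server of $S$; its cost is the sum of client–server distances. A minimum-cost matching minimizes this cost.
   Formalization: The distances of the metric space $(\mathcal{X},d)$ take rational values. -}

module Defs where

open import Data.Nat using (ℕ; zero; suc; _∸_) renaming (_+_ to _+ℕ_)
open import Data.Fin using (Fin; zero; suc; toℕ)
open import Data.Rational using (ℚ; 0ℚ; _+_; _≤_)
open import Data.Product using (Σ; ∃; _×_)
open import Relation.Binary.PropositionalEquality using (_≡_)
open import Relation.Nullary using (¬_)

record Metric (X : Set) : Set where
  field
    d        : X → X → ℚ
    nonneg   : ∀ x y → 0ℚ ≤ d x y
    zero-iff : ∀ x y → d x y ≡ 0ℚ → x ≡ y
    self     : ∀ x → d x x ≡ 0ℚ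
    sym      : ∀ x y → d x y ≡ d y x
    triangle : ∀ x y z → d x z ≤ d x y + d y z

sumFin : (n : ℕ) → (Fin n → ℚ) → ℚ
sumFin zero    f = 0ℚ
sumFin (suc n) f = f zero + sumFin n (λ i → f (suc i))

Injective : {n m : ℕ} → (Fin n → Fin m) → Set
Injective {n} f = ∀ (i j : Fin n) → f i ≡ f j → i ≡ j

module Matching {X : Set} (M : Metric X) {m : ℕ} (srv : Fin m → X) (c : ℕ → X) where
  open Metric M

  -- A matching of C_j = (c_1,…,c_j) into S: an injective assignment of server
  -- indices to the j first clients (clients are 0-indexed: c 0 = c_1).
  IsMatching : (j : ℕ) → (Fin j → Fin m) → Set
  IsMatching j μ = Injective μ

  cost : (j : ℕ) → (Fin j → Fin m) → ℚ
  cost j μ = sumFin j (λ i → d (c (toℕ i)) (srv (μ i)))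

  IsMinMatching : (j : ℕ) → (Fin j → Fin m) → Set
  IsMinMatching j μ = IsMatching j μ × (∀ ν → IsMatching j ν → cost j μ ≤ cost j ν)

  Used : {j : ℕ} → (Fin j → Fin m) → Fin m → Set
  Used μ s = ∃ λ i → μ i ≡ s

  UsedSubset : {a n : ℕ} → (Fin a → Fin m) → (Fin n → Fin m) → Set
  UsedSubset μ₁ μ₂ = ∀ s → Used μ₁ s → Used μ₂ s

  InCur : {a n : ℕ} → (Fin a → Fin m) → (Fin n → Fin m) → Fin m → Set
  InCur μ₁ μ₂ s = Used μ₂ s × ¬ Used μ₁ s

  -- Current clients: c_{a+1},…,c_{a+k}, i.e. indices a + j for j : Fin k.
  -- A perfect matching between C_cur and S_cur: a bijection Fin k → S_cur.
  IsPerfectCur : {a n : ℕ} (k : ℕ) → (Fin a → Fin m) → (Fin n → Fin m) → (Fin k → Fin m) → Set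
  IsPerfectCur k μ₁ μ₂ g =
    Injective g × (∀ j → InCur μ₁ μ₂ (g j)) × (∀ s → InCur μ₁ μ₂ s → ∃ λ j → g j ≡ s)

  costCur : (a k : ℕ) → (Fin k → Fin m) → ℚ
  costCur a k g = sumFin k (λ j → d (c (a +ℕ toℕ j)) (srv (g j)))

{-# OPTIONS --safe #-}
module Submission where

-- Remove the old clients one at a time.  The first old client c₀ is served by
-- s = μ₁(c₀), which μ₂ gives to some client x; let x take over μ₂(c₀) and drop
-- c₀ together with s.  This preserves S_cur, and by the triangle inequality
--   d(x, μ₂(c₀)) ≤ d(x, s) + d(s, c₀) + d(c₀, μ₂(c₀))
-- the new matching costs at most d(c₀, s) more than μ₂.  Once every old client is
-- gone, what is left is a perfect matching of C_cur onto S_cur of cost at most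
-- cost(μ₁) + cost(μ₂) ≤ 2·cost(μ₂), as μ₁ is optimal and μ₂ restricted to C_{t-1}
-- is a matching of C_{t-1}.

open import Defs
open import Data.Nat using (ℕ; zero; suc; _∸_; _+_; s≤s; z≤n)
import Data.Nat.Properties as ℕ
open import Data.Fin using (Fin; zero; suc; toℕ; _↑ˡ_; _↑ʳ_; _≟_)
open import Data.Fin.Properties using (suc-injective; ↑ˡ-injective; 0≢1+n)
open import Data.Vec.Functional using (Vector; head; tail; updateAt)
open import Data.Vec.Functional.Properties using (updateAt-updates; updateAt-minimal)
open import Data.Rational using (ℚ; 0ℚ; 1ℚ; _≤_; _*_) renaming (_+_ to _+ℚ_)
open import Data.Rational.Properties
  using (≤-refl; ≤-reflexive; ≤-trans; +-mono-≤; +-monoˡ-≤; +-monoʳ-≤; +-assoc; +-comm;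
         +-identityˡ; +-identityʳ; *-identityˡ; *-distribʳ-+; +-0-commutativeMonoid; module ≤-Reasoning)
open import Algebra.Bundles using (CommutativeMonoid)
open import Algebra.Properties.CommutativeSemigroup
  (CommutativeMonoid.commutativeSemigroup +-0-commutativeMonoid)
  using (xy∙z≈x∙zy)
open import Data.Product using (_×_; _,_; proj₁; ∃-syntax)
open import Function using (_∘_; const; _⇔_; mk⇔; Equivalence)
open import Relation.Nullary using (yes; no; contradiction)
open import Relation.Binary.PropositionalEquality using (_≡_; _≢_; refl; sym; trans; cong; cong₂; subst)

p≤q⇒p≤r+q : ∀ {p q r} → 0ℚ ≤ r → p ≤ q → p ≤ r +ℚ q
p≤q⇒p≤r+q {p} {q} {r} 0≤r p≤q = subst (_≤ r +ℚ q) (+-identityˡ p) (+-mono-≤ 0≤r p≤q)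

sumFin-nonneg : ∀ n (f : Fin n → ℚ) → (∀ i → 0ℚ ≤ f i) → 0ℚ ≤ sumFin n f
sumFin-nonneg zero    f f≥0 = ≤-refl
sumFin-nonneg (suc n) f f≥0 = p≤q⇒p≤r+q (f≥0 zero) (sumFin-nonneg n (f ∘ suc) (f≥0 ∘ suc))

sumFin-updateAt-≤ : ∀ {A : Set} n (F : Fin n → A → ℚ) (ν : Vector A n) y (f : A → A) δ →
  F y (f (ν y)) ≤ F y (ν y) +ℚ δ →
  sumFin n (λ i → F i (updateAt ν y f i)) ≤ sumFin n (λ i → F i (ν i)) +ℚ δ
sumFin-updateAt-≤ (suc n) F ν zero f δ Fy≤ = begin
  F zero (f (ν zero)) +ℚ rest        ≤⟨ +-monoˡ-≤ rest Fy≤ ⟩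
  (F₀ +ℚ δ) +ℚ rest                  ≡⟨ xy∙z≈x∙zy F₀ δ rest ⟩
  F₀ +ℚ (rest +ℚ δ)                  ≡⟨ sym (+-assoc F₀ rest δ) ⟩
  (F₀ +ℚ rest) +ℚ δ                  ∎
  where
  open ≤-Reasoning
  F₀   = F zero (ν zero)
  rest = sumFin n (λ i → F (suc i) (ν (suc i)))
sumFin-updateAt-≤ (suc n) F ν (suc y) f δ Fy≤ =
  subst (_ ≤_) (sym (+-assoc (F zero (ν zero)) _ δ))
    (+-monoʳ-≤ (F zero (ν zero)) (sumFin-updateAt-≤ n (F ∘ suc) (tail ν) y f δ Fy≤))

reroute : ∀ {A : Set} {n} → Vector A (suc n) → Fin (suc n) → Vector A n
reroute μ x = tail (updateAt μ x (const (head μ)))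

module _ {A : Set} {n} (μ : Vector A (suc n)) where

  reroute-at : ∀ {x z} → suc z ≡ x → reroute μ x z ≡ head μ
  reroute-at {z = z} refl = updateAt-updates (suc z) μ

  reroute-off : ∀ {x z} → suc z ≢ x → reroute μ x z ≡ μ (suc z)
  reroute-off {x} {z} sz≢x = updateAt-minimal (suc z) x μ sz≢x

  reroute-image : ∀ x z → ∃[ w ] μ w ≡ reroute μ x z
  reroute-image x z with suc z ≟ x
  ... | yes sz≡x = zero , sym (reroute-at sz≡x)
  ... | no  sz≢x = suc z , sym (reroute-off sz≢x)

  reroute-covers : ∀ x w → w ≢ x → ∃[ z ] reroute μ x z ≡ μ w
  reroute-covers zero    zero    0≢0 = contradiction refl 0≢0
  reroute-covers (suc y) zero    _   = y , reroute-at refl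
  reroute-covers x       (suc z) w≢x = z , reroute-off w≢x

module _ {n m} {μ : Fin (suc n) → Fin m} (inj : Injective μ) (x : Fin (suc n)) where

  reroute-injective : Injective (reroute μ x)
  reroute-injective z₁ z₂ eq with suc z₁ ≟ x | suc z₂ ≟ x
  ... | yes p | yes q = suc-injective (trans p (sym q))
  ... | yes p | no  q =
    contradiction (inj _ _ (trans (sym (reroute-at μ p)) (trans eq (reroute-off μ q)))) 0≢1+n
  ... | no  p | yes q =
    contradiction (inj _ _ (trans (sym (reroute-at μ q)) (trans (sym eq) (reroute-off μ p)))) 0≢1+n
  ... | no  p | no  q =
    suc-injective (inj _ _ (trans (sym (reroute-off μ p)) (trans eq (reroute-off μ q))))

  reroute-avoids : ∀ z → reroute μ x z ≢ μ x
  reroute-avoids z eq with suc z ≟ x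
  ... | yes sz≡x = 0≢1+n (trans (inj _ _ (trans (sym (reroute-at μ sz≡x)) eq)) (sym sz≡x))
  ... | no  sz≢x = sz≢x (inj _ _ (trans (sym (reroute-off μ sz≢x)) eq))

module _ {X : Set} (M : Metric X) where
  open Metric M renaming (sym to d-sym)

  d-detour : ∀ x y z w → d x w ≤ d x y +ℚ (d z y +ℚ d z w)
  d-detour x y z w = begin
    d x w                       ≤⟨ triangle x z w ⟩
    d x z +ℚ d z w              ≤⟨ +-monoˡ-≤ (d z w) (triangle x y z) ⟩
    (d x y +ℚ d y z) +ℚ d z w   ≡⟨ +-assoc (d x y) (d y z) (d z w) ⟩
    d x y +ℚ (d y z +ℚ d z w)   ≡⟨ cong (λ e → d x y +ℚ (e +ℚ d z w)) (d-sym y z) ⟩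
    d x y +ℚ (d z y +ℚ d z w)   ∎
    where open ≤-Reasoning

module _ {X : Set} (M : Metric X) {m : ℕ} (srv : Fin m → X) where
  open Metric M using (d; nonneg)
  open Matching M srv

  cost-reroute : ∀ c {n} (μ : Fin (suc n) → Fin m) x →
    cost (c ∘ suc) n (reroute μ x) ≤ d (c 0) (srv (μ x)) +ℚ cost c (suc n) μ
  cost-reroute c μ zero = p≤q⇒p≤r+q (nonneg _ _) (p≤q⇒p≤r+q (nonneg _ _) ≤-refl)
  cost-reroute c {n} μ (suc y) = begin
    cost (c ∘ suc) n (reroute μ (suc y))
      ≤⟨ sumFin-updateAt-≤ n F (tail μ) y (const (head μ)) (dₓ +ℚ d₀) detour ⟩
    rest +ℚ (dₓ +ℚ d₀)                    ≡⟨ +-comm rest (dₓ +ℚ d₀) ⟩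
    (dₓ +ℚ d₀) +ℚ rest                    ≡⟨ +-assoc dₓ d₀ rest ⟩
    dₓ +ℚ (d₀ +ℚ rest)                    ∎
    where
    open ≤-Reasoning
    F : Fin n → Fin m → ℚ
    F i s = d (c (suc (toℕ i))) (srv s)
    dₓ = d (c 0) (srv (μ (suc y)))
    d₀ = d (c 0) (srv (μ zero))
    rest = cost (c ∘ suc) n (tail μ)
    detour : F y (head μ) ≤ F y (μ (suc y)) +ℚ (dₓ +ℚ d₀)
    detour = d-detour M (c (suc (toℕ y))) (srv (μ (suc y))) (c 0) (srv (μ zero))

  module _ (c : ℕ → X) {a n} {σ : Fin (suc a) → Fin m} {μ : Fin (suc n) → Fin m} {x : Fin (suc n)}
           (injσ : Injective σ) (injμ : Injective μ) (μx≡σ₀ : μ x ≡ σ zero) where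

    UsedSubset-reroute : UsedSubset c σ μ → UsedSubset c (tail σ) (reroute μ x)
    UsedSubset-reroute σ⊆μ s (i , σᵢ≡s) with σ⊆μ s (suc i , σᵢ≡s)
    ... | w , μw≡s with reroute-covers μ x w w≢x
      where
      w≢x : w ≢ x
      w≢x refl = 0≢1+n (injσ _ _ (trans (sym μx≡σ₀) (trans μw≡s (sym σᵢ≡s))))
    ... | z , eq = z , trans eq μw≡s

    InCur-reroute : ∀ s → InCur c (tail σ) (reroute μ x) s ⇔ InCur c σ μ s
    InCur-reroute s = mk⇔ to from
      where
      to : InCur c (tail σ) (reroute μ x) s → InCur c σ μ s
      to ((z , eq) , s∉σ') with reroute-image μ x z
      ... | w , μw≡r = (w , trans μw≡r eq) , λ
        { (zero  , σ₀≡s) → reroute-avoids injμ x z (trans eq (sym (trans μx≡σ₀ σ₀≡s)))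
        ; (suc i , σᵢ≡s) → s∉σ' (i , σᵢ≡s) }
      from : InCur c σ μ s → InCur c (tail σ) (reroute μ x) s
      from ((w , μw≡s) , s∉σ) with reroute-covers μ x w w≢x
        where
        w≢x : w ≢ x
        w≢x refl = s∉σ (zero , trans (sym μx≡σ₀) μw≡s)
      ... | z , eq = (z , trans eq μw≡s) , λ (i , σᵢ≡s) → s∉σ (suc i , σᵢ≡s)

  IsPerfectCur-resp : ∀ c k {a a′ n n′} {σ : Fin a → Fin m} {μ : Fin n → Fin m}
    {σ′ : Fin a′ → Fin m} {μ′ : Fin n′ → Fin m} {h : Fin k → Fin m} →
    (∀ s → InCur c σ′ μ′ s ⇔ InCur c σ μ s) →
    IsPerfectCur c k σ′ μ′ h → IsPerfectCur c k σ μ h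
  IsPerfectCur-resp c k same (injh , into , onto) =
    injh , (λ j → Equivalence.to (same _) (into j)) , (λ s → onto s ∘ Equivalence.from (same s))

  perfectCur-≤-cost+cost : ∀ a k c (σ : Fin a → Fin m) (μ : Fin (a + k) → Fin m) →
    Injective σ → Injective μ → UsedSubset c σ μ →
    ∃[ h ] IsPerfectCur c k σ μ h × costCur c a k h ≤ cost c a σ +ℚ cost c (a + k) μ
  perfectCur-≤-cost+cost zero k c σ μ _ injμ _ =
    μ , (injμ , (λ j → (j , refl) , λ ()) , (λ s → proj₁)) , ≤-reflexive (sym (+-identityˡ _))
  perfectCur-≤-cost+cost (suc a) k c σ μ injσ injμ σ⊆μ with σ⊆μ (σ zero) (zero , refl)
  ... | x , μx≡σ₀ with perfectCur-≤-cost+cost a k (c ∘ suc) (tail σ) (reroute μ x)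
                         (λ i j eq → suc-injective (injσ _ _ eq)) (reroute-injective injμ x)
                         (UsedSubset-reroute c injσ injμ μx≡σ₀ σ⊆μ)
  ... | h , perfect , h≤ =
    -- costCur c (suc a) k h computes to costCur (c ∘ suc) a k h, as suc a + j = suc (a + j).
    h , IsPerfectCur-resp c k (InCur-reroute c injσ injμ μx≡σ₀) perfect , (begin
      costCur (c ∘ suc) a k h                   ≤⟨ h≤ ⟩
      costσ′ +ℚ cost (c ∘ suc) (a + k) (reroute μ x)
                                                ≤⟨ +-monoʳ-≤ costσ′ (cost-reroute c μ x) ⟩
      costσ′ +ℚ (dₓ +ℚ costμ)                   ≡⟨ sym (+-assoc costσ′ dₓ costμ) ⟩
      (costσ′ +ℚ dₓ) +ℚ costμ                   ≡⟨ cong (_+ℚ costμ) (+-comm costσ′ dₓ) ⟩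
      (dₓ +ℚ costσ′) +ℚ costμ                   ≡⟨ cong (λ s → (d (c 0) (srv s) +ℚ costσ′) +ℚ costμ) μx≡σ₀ ⟩
      cost c (suc a) σ +ℚ costμ                 ∎)
    where
    open ≤-Reasoning
    costσ′ = cost (c ∘ suc) a (tail σ)
    costμ = cost c (suc a + k) μ
    dₓ = d (c 0) (srv (μ x))

  cost-++ : ∀ c a k (μ : Fin (a + k) → Fin m) →
    cost c (a + k) μ ≡ cost c a (μ ∘ (_↑ˡ k)) +ℚ costCur c a k (μ ∘ (a ↑ʳ_))
  cost-++ c zero    k μ = sym (+-identityˡ _)
  cost-++ c (suc a) k μ = trans (cong (d₀ +ℚ_) (cost-++ (c ∘ suc) a k (tail μ)))
                                (sym (+-assoc d₀ (cost (c ∘ suc) a (tail μ ∘ (_↑ˡ k)))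
                                                 (costCur (c ∘ suc) a k (tail μ ∘ (a ↑ʳ_)))))
    where d₀ = d (c 0) (srv (μ zero))

  cost-↑ˡ-≤ : ∀ c a k (μ : Fin (a + k) → Fin m) → cost c a (μ ∘ (_↑ˡ k)) ≤ cost c (a + k) μ
  cost-↑ˡ-≤ c a k μ = begin
    prefix              ≡⟨ sym (+-identityʳ prefix) ⟩
    prefix +ℚ 0ℚ        ≤⟨ +-monoʳ-≤ prefix (sumFin-nonneg k _ (λ j → nonneg _ _)) ⟩
    prefix +ℚ suffix    ≡⟨ sym (cost-++ c a k μ) ⟩
    cost c (a + k) μ    ∎
    where
    open ≤-Reasoning
    prefix = cost c a (μ ∘ (_↑ˡ k))
    suffix = costCur c a k (μ ∘ (a ↑ʳ_))

  -- N is kept apart from a + k because the theorem's t + ℓ is only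
  -- propositionally equal to (t ∸ 1) + suc ℓ.
  costCur-≤-2*cost : ∀ c a k {N} → a + k ≡ N →
    (μ₁ : Fin a → Fin m) (μ₂ : Fin N → Fin m) →
    IsMinMatching c a μ₁ → IsMatching c N μ₂ → UsedSubset c μ₁ μ₂ →
    (g : Fin k → Fin m) →
    (∀ g′ → IsPerfectCur c k μ₁ μ₂ g′ → costCur c a k g ≤ costCur c a k g′) →
    costCur c a k g ≤ (1ℚ +ℚ 1ℚ) * cost c N μ₂
  costCur-≤-2*cost c a k refl μ₁ μ₂ (injμ₁ , μ₁-min) injμ₂ μ₁⊆μ₂ g g-min
    with perfectCur-≤-cost+cost a k c μ₁ μ₂ injμ₁ injμ₂ μ₁⊆μ₂
  ... | h , h-perfect , h≤ = begin
    costCur c a k g                 ≤⟨ g-min h h-perfect ⟩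
    costCur c a k h                 ≤⟨ h≤ ⟩
    cost c a μ₁ +ℚ OPT              ≤⟨ +-monoˡ-≤ OPT (≤-trans (μ₁-min (μ₂ ∘ (_↑ˡ k)) restrict-injective)
                                                             (cost-↑ˡ-≤ c a k μ₂)) ⟩
    OPT +ℚ OPT                      ≡⟨ sym (2*p≡p+p OPT) ⟩
    (1ℚ +ℚ 1ℚ) * OPT                ∎
    where
    open ≤-Reasoning
    OPT = cost c (a + k) μ₂
    restrict-injective : Injective (μ₂ ∘ (_↑ˡ k))
    restrict-injective i j eq = ↑ˡ-injective k i j (injμ₂ _ _ eq)
    2*p≡p+p : ∀ p → (1ℚ +ℚ 1ℚ) * p ≡ p +ℚ p
    2*p≡p+p p = trans (*-distribʳ-+ p 1ℚ 1ℚ) (cong₂ _+ℚ_ (*-identityˡ p) (*-identityˡ p))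

mainTheorem7 :
    (X : Set) (M : Metric X) (m : ℕ) (srv : Fin m → X) (c : ℕ → X)
    (t ℓ : ℕ) → 1 Data.Nat.≤ t →
    (μ₁ : Fin (t ∸ 1) → Fin m) (μ₂ : Fin (t + ℓ) → Fin m) →
    Matching.IsMinMatching M srv c (t ∸ 1) μ₁ →
    Matching.IsMinMatching M srv c (t + ℓ) μ₂ →
    Matching.UsedSubset M srv c μ₁ μ₂ →
    (g : Fin (suc ℓ) → Fin m) →
    Matching.IsPerfectCur M srv c (suc ℓ) μ₁ μ₂ g →
    (∀ g′ → Matching.IsPerfectCur M srv c (suc ℓ) μ₁ μ₂ g′ →
       Matching.costCur M srv c (t ∸ 1) (suc ℓ) g ≤ Matching.costCur M srv c (t ∸ 1) (suc ℓ) g′) →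
    Matching.costCur M srv c (t ∸ 1) (suc ℓ) g
      ≤ (1ℚ +ℚ 1ℚ) * Matching.cost M srv c (t + ℓ) μ₂
mainTheorem7 X M m srv c (suc t) ℓ (s≤s z≤n) μ₁ μ₂ μ₁-min (injμ₂ , _) μ₁⊆μ₂ g _ g-min =
  costCur-≤-2*cost M srv c t (suc ℓ) (ℕ.+-suc t ℓ) μ₁ μ₂ μ₁-min injμ₂ μ₁⊆μ₂ g g-min
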